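{- Let $s$ be a positive integer and let $\lambda$ be a self-conjugate partition. Then $\lambda$ is an $(s,s+1,s+2)$-core if and only if the set $MD(\lambda)$ of main diagonal hook lengths of $\lambda$ is a lower ideal of the poset $\tilde{P}_{\{s,s+1,s+2\}}$ and contains no (not necessarily distinct) elements $h_1,h_2$ with $h_1+h_2\in\{2s,2s+2,2s+4\}$.
   Context: For a partition $\lambda$ with conjugate $\lambda'$, the hook length of box $(i,j)$ is $\lambda_i+\lambda'_j-i-j+1$; $\lambda$ is self-conjugate if $\lambda=\lambda'$; it is a $t$-core if no hook length is a multiple of $t$, and an $(s,s+1,s+2)$-core if it is simultaneously an $s$-, $(s+1)$- and $(s+2)$-core. $MD(\lambda)$ is the set of hook lengths $h(i,i)$ of the main diagonal boxes. For a set $S$ of positive integers, $P_S$ is the set of positive integers that are not non-negative integer combinations of elements of $S$, partially ordered by: $b\le_{P} a$ iff $a-b$ is a non-negative integer combination of elements of $S$ (equivalently, the order generated by the cover relation "$a$ covers $b$ iff $a-b\in S$"). Let $P=P_{\{2s,2s+1,2s+2,2s+3,2s+4\}}$ and define the induced subposet $\tilde{P}_{\{s,s+1,s+2\}}=\{h\in P : h \text{ odd},\ s\not\le_P h,\ s+1\not\le_P h,\ s+2\not\le_P h\}$. A lower ideal of a poset is a subset $I$ such that $a<b$ and $b\in I$ imply $a\in I$. -}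

module Defs where

open import Data.Nat using (ℕ; zero; suc; _+_; _*_; _∸_; _≤_; _<_; _≤?_)
open import Data.Nat.Divisibility using (_∣_)
open import Data.List using (List; []; _∷_; length; filter; applyUpTo)
open import Data.List.Relation.Unary.All using (All)
open import Data.List.Relation.Unary.Linked using (Linked)
open import Data.Product using (_×_; ∃; ∃-syntax; _,_)
open import Data.Sum using (_⊎_)
open import Relation.Nullary using (¬_)
open import Relation.Binary.PropositionalEquality using (_≡_)

IsPartition : List ℕ → Set
IsPartition la = Linked (λ a b → b ≤ a) la × All (λ a → 0 < a) la

-- part la i = λ_i (1-indexed); 0 for i = 0 or i beyond the length.
part : List ℕ → ℕ → ℕ
part []       _             = 0
part (x ∷ xs) zero          = 0
part (x ∷ xs) (suc zero)    = x
part (x ∷ xs) (suc (suc i)) = part xs (suc i)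

conjPart : List ℕ → ℕ → ℕ
conjPart la j = length (filter (λ x → j ≤? x) la)

conj : List ℕ → List ℕ
conj la = applyUpTo (λ k → conjPart la (suc k)) (part la 1)

SelfConjugate : List ℕ → Set
SelfConjugate la = la ≡ conj la

-- (i , j) is a box of the Young diagram (1-indexed).
Box : List ℕ → ℕ → ℕ → Set
Box la i j = 1 ≤ i × 1 ≤ j × j ≤ part la i

hook : List ℕ → ℕ → ℕ → ℕ
hook la i j = (part la i + conjPart la j + 1) ∸ (i + j)

IsCore : ℕ → List ℕ → Set
IsCore t la = ∀ i j → Box la i j → ¬ (t ∣ hook la i j)

MD : List ℕ → ℕ → Set
MD la h = ∃[ i ] (Box la i i × hook la i i ≡ h)

-- Non-negative integer combinations of S = {2s, 2s+1, 2s+2, 2s+3, 2s+4}.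
data Comb (s : ℕ) : ℕ → Set where
  comb-zero : Comb s 0
  comb-add  : ∀ {k n} → k ≤ 4 → Comb s n → Comb s ((2 * s + k) + n)

InP : ℕ → ℕ → Set
InP s a = 0 < a × ¬ Comb s a

LeP : ℕ → ℕ → ℕ → Set
LeP s b a = InP s b × InP s a × ∃[ c ] (Comb s c × a ≡ b + c)

Odd : ℕ → Set
Odd h = ∃[ m ] (h ≡ suc (2 * m))

InPtilde : ℕ → ℕ → Set
InPtilde s h = InP s h × Odd h
             × ¬ LeP s s h × ¬ LeP s (suc s) h × ¬ LeP s (suc (suc s)) h

LowerIdealPtilde : ℕ → (ℕ → Set) → Set
LowerIdealPtilde s I =
  (∀ h → I h → InPtilde s h) ×
  (∀ a b → InPtilde s a → InPtilde s b → LeP s a b → I b → I a)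

NoBadSum : ℕ → (ℕ → Set) → Set
NoBadSum s I = ∀ h₁ h₂ → I h₁ → I h₂ →
  ¬ (h₁ + h₂ ≡ 2 * s ⊎ h₁ + h₂ ≡ 2 * s + 2 ⊎ h₁ + h₂ ≡ 2 * s + 4)

-- For self-conjugate λ, let D be the set of Frobenius coordinates λᵢ - i ≥ 0; its complement
-- in ℕ is the set of the j - λⱼ - 1 ≥ 0.  Every hook length is a + b + 1 with a, b ∈ D or a - c
-- with a ∈ D, c ∉ D, so λ is a t-core iff D is closed under subtracting t and has no a, b with
-- a + b + 1 = t.  Now MD(λ) = 2D + 1, the sums of two of s, s+1, s+2 are exactly
-- S = {2s, …, 2s+4}, and 2a+1 + 2b+1 = 2(a+b+1): closure of D under s, s+1, s+2 becomes MD(λ)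
-- being a lower ideal of P̃, and a + b + 1 ∈ {s, s+1, s+2} becomes a forbidden sum.

module Submission where

open import Defs
open import Data.Nat using (ℕ; zero; suc; _+_; _*_; _∸_; _≤_; _<_; _≤?_; _<?_; z≤n; s≤s; NonZero; >-nonZero)
open import Data.Nat.Properties
open import Data.Nat.Divisibility using (_∣_; divides; ∣-refl; ∣m+n∣m⇒∣n; n∣m*n)
open import Data.Nat.DivMod using (_%_; _/_; m≡m%n+[m/n]*n; m%n<n)
open import Data.Nat.Solver using (module +-*-Solver)
open +-*-Solver using (solve; _:+_; _:*_; _:=_; con)
open import Data.List using (List; []; _∷_; length; applyUpTo)
open import Data.List.Properties using (filter-accept; filter-reject)
open import Data.List.Relation.Unary.Linked using (Linked; _∷_)
open import Data.Product using (∃-syntax; ∃₂; _×_; _,_; proj₁; proj₂; uncurry)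
open import Data.Sum using (_⊎_; inj₁; inj₂)
open import Data.Empty using (⊥-elim)
open import Function.Base using (_∘_)
open import Function.Bundles using (_⇔_; mk⇔; Equivalence)
open import Function.Properties.Equivalence using () renaming (trans to ⇔-trans)
open import Relation.Nullary using (¬_; yes; no; contradiction)
open import Relation.Binary.Definitions using (tri<; tri≈; tri>)
open import Relation.Binary.PropositionalEquality

Decreasing : List ℕ → Set
Decreasing = Linked (λ a b → b ≤ a)

conjPart-∷-≤ : ∀ {j x} xs → j ≤ x → conjPart (x ∷ xs) j ≡ suc (conjPart xs j)
conjPart-∷-≤ {j} xs j≤x = cong length (filter-accept (j ≤?_) j≤x)

conjPart-∷-≰ : ∀ {j x} xs → ¬ j ≤ x → conjPart (x ∷ xs) j ≡ conjPart xs j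
conjPart-∷-≰ {j} xs j≰x = cong length (filter-reject (j ≤?_) j≰x)

part-tail≤head : ∀ {x xs} → Decreasing (x ∷ xs) → ∀ k → part xs k ≤ x
part-tail≤head {xs = []} _ _ = z≤n
part-tail≤head {xs = y ∷ ys} _ zero = z≤n
part-tail≤head {xs = y ∷ ys} (y≤x ∷ _) (suc zero) = y≤x
part-tail≤head {xs = y ∷ ys} (y≤x ∷ d) (suc (suc k)) = ≤-trans (part-tail≤head d (suc k)) y≤x

conjPart-head< : ∀ {j x xs} → Decreasing (x ∷ xs) → x < j → conjPart (x ∷ xs) j ≡ 0
conjPart-head< {xs = []} _ x<j = conjPart-∷-≰ [] (<⇒≱ x<j)
conjPart-head< {xs = y ∷ ys} (y≤x ∷ d) x<j =
  trans (conjPart-∷-≰ (y ∷ ys) (<⇒≱ x<j)) (conjPart-head< d (≤-<-trans y≤x x<j))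

≤-part⇒≤-conjPart : ∀ {la} → Decreasing la → ∀ i {j} → 1 ≤ j → j ≤ part la i → i ≤ conjPart la j
≤-part⇒≤-conjPart _ zero _ _ = z≤n
≤-part⇒≤-conjPart {[]} _ (suc i) (s≤s _) ()
≤-part⇒≤-conjPart {x ∷ xs} _ (suc zero) _ j≤x rewrite conjPart-∷-≤ xs j≤x = s≤s z≤n
≤-part⇒≤-conjPart {x ∷ []} _ (suc (suc i)) (s≤s _) ()
≤-part⇒≤-conjPart {x ∷ y ∷ ys} d@(_ ∷ d′) (suc (suc i)) 1≤j j≤part
  rewrite conjPart-∷-≤ (y ∷ ys) (≤-trans j≤part (part-tail≤head d (suc i))) =
  s≤s (≤-part⇒≤-conjPart d′ (suc i) 1≤j j≤part)

part-applyUpTo-< : ∀ (f : ℕ → ℕ) {n k} → k < n → part (applyUpTo f n) (suc k) ≡ f k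
part-applyUpTo-< f {suc n} {zero} _ = refl
part-applyUpTo-< f {suc n} {suc k} (s≤s k<n) = part-applyUpTo-< (f ∘ suc) k<n

part-applyUpTo-≥ : ∀ (f : ℕ → ℕ) {n k} → n ≤ k → part (applyUpTo f n) (suc k) ≡ 0
part-applyUpTo-≥ f {zero} _ = refl
part-applyUpTo-≥ f {suc n} {suc k} (s≤s n≤k) = part-applyUpTo-≥ (f ∘ suc) n≤k

part-conj : ∀ {la} → Decreasing la → ∀ k → part (conj la) (suc k) ≡ conjPart la (suc k)
part-conj {[]} _ _ = refl
part-conj {x ∷ xs} d k with k <? x
... | yes k<x = part-applyUpTo-< _ k<x
... | no k≮x = trans (part-applyUpTo-≥ _ (≮⇒≥ k≮x)) (sym (conjPart-head< d (s≤s (≮⇒≥ k≮x))))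

module _ (D : ℕ → Set) where

  DownClosed : ℕ → Set
  DownClosed t = ∀ x → D (x + t) → D x

  NoPairSum : ℕ → Set
  NoPairSum t = ∀ {a b} → D a → D b → suc (a + b) ≢ t

module _ {D : ℕ → Set} {t : ℕ} (downClosed : DownClosed D t) where

  downClosed-multiple : ∀ q {x} → D (x + q * t) → D x
  downClosed-multiple zero {x} = subst D (+-identityʳ x)
  downClosed-multiple (suc q) {x} Dx+qt =
    downClosed-multiple q (downClosed (x + q * t) (subst D (x+[t+qt]≡[x+qt]+t) Dx+qt))
    where
    x+[t+qt]≡[x+qt]+t : x + (t + q * t) ≡ x + q * t + t
    x+[t+qt]≡[x+qt]+t = solve 3 (λ x t y → x :+ (t :+ y) := x :+ y :+ t) refl x t (q * t)

  downClosed⇒∤difference : ∀ {a c} → D a → ¬ D c → c < a → ¬ t ∣ a ∸ c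
  downClosed⇒∤difference {a} {c} Da ¬Dc c<a (divides q a∸c≡qt) =
    ¬Dc (downClosed-multiple q (subst D a≡c+qt Da))
    where
    a≡c+qt : a ≡ c + q * t
    a≡c+qt = trans (sym (m+[n∸m]≡n (<⇒≤ c<a))) (cong (c +_) a∸c≡qt)

  multiple-between-0-and-double : ∀ {n} → t ∣ n → 0 < n → n < t + t → n ≡ t
  multiple-between-0-and-double (divides zero refl) ()
  multiple-between-0-and-double (divides (suc zero) n≡t+0) _ _ = trans n≡t+0 (+-identityʳ t)
  multiple-between-0-and-double (divides (suc (suc q)) refl) _ n<2t =
    contradiction (+-monoʳ-≤ t (m≤m+n t (q * t))) (<⇒≱ n<2t)

  -- Reducing a and b modulo t keeps them in D and leaves a pair sum of size in (0, 2t).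
  downClosed⇒∤pairSum : .{{_ : NonZero t}} → NoPairSum D t → ∀ {a b} → D a → D b → ¬ t ∣ suc (a + b)
  downClosed⇒∤pairSum noPairSum {a} {b} Da Db t∣ =
    noPairSum (reduce Da) (reduce Db) (multiple-between-0-and-double t∣r (s≤s z≤n) r<2t)
    where
    reduce : ∀ {x} → D x → D (x % t)
    reduce {x} Dx = downClosed-multiple (x / t) (subst D (m≡m%n+[m/n]*n x t) Dx)
    r = suc (a % t + b % t)
    split : suc (a + b) ≡ r + (a / t + b / t) * t
    split = begin
      suc (a + b)                                         ≡⟨ cong₂ (λ x y → suc (x + y)) (m≡m%n+[m/n]*n a t) (m≡m%n+[m/n]*n b t) ⟩
      suc ((a % t + a / t * t) + (b % t + b / t * t))     ≡⟨ solve 5 (λ u v w x y → con 1 :+ ((u :+ v :* y) :+ (w :+ x :* y))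
                                                                                := con 1 :+ (u :+ w) :+ (v :+ x) :* y)
                                                                  refl (a % t) (a / t) (b % t) (b / t) t ⟩
      r + (a / t + b / t) * t                              ∎
      where open ≡-Reasoning
    t∣r : t ∣ r
    t∣r = ∣m+n∣m⇒∣n (subst (t ∣_) (trans split (+-comm r _)) t∣) (n∣m*n (a / t + b / t))
    r<2t : r < t + t
    r<2t = ≤-trans (s≤s (≤-reflexive (sym (+-suc (a % t) (b % t))))) (+-mono-≤ (m%n<n a t) (m%n<n b t))

module Frobenius (L : ℕ → ℕ) (transpose : ∀ {i j} → 1 ≤ j → j ≤ L i → i ≤ L j) where

  Frob : ℕ → Set
  Frob a = ∃[ i ] (1 ≤ i × L i ≡ a + i)

  CoFrob : ℕ → Set
  CoFrob c = ∃[ j ] (1 ≤ j × suc (L j + c) ≡ j)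

  Hook : ℕ → ℕ → ℕ
  Hook i j = (L i + L j + 1) ∸ (i + j)

  HookFree : ℕ → Set
  HookFree t = ∀ {i j} → 1 ≤ i → 1 ≤ j → j ≤ L i → ¬ t ∣ Hook i j

  Hook-comm : ∀ i j → Hook i j ≡ Hook j i
  Hook-comm i j = cong₂ _∸_ (cong (_+ 1) (+-comm (L i) (L j))) (+-comm i j)

  Hook-frob-frob : ∀ {i j a b} → L i ≡ a + i → L j ≡ b + j → Hook i j ≡ suc (a + b)
  Hook-frob-frob {i} {j} {a} {b} Li Lj = begin
    (L i + L j + 1) ∸ (i + j)              ≡⟨ cong₂ (λ x y → (x + y + 1) ∸ (i + j)) Li Lj ⟩
    (a + i + (b + j) + 1) ∸ (i + j)        ≡⟨ cong (_∸ (i + j)) (solve 4 (λ a b i j → a :+ i :+ (b :+ j) :+ con 1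
                                                                          := con 1 :+ (a :+ b) :+ (i :+ j)) refl a b i j) ⟩
    (suc (a + b) + (i + j)) ∸ (i + j)      ≡⟨ m+n∸n≡m (suc (a + b)) (i + j) ⟩
    suc (a + b)                            ∎
    where open ≡-Reasoning

  Hook-frob-cofrob : ∀ {i j a c} → c ≤ a → L i ≡ a + i → suc (L j + c) ≡ j → Hook i j ≡ a ∸ c
  Hook-frob-cofrob {i} {j} {a} {c} c≤a Li Lj = begin
    (L i + L j + 1) ∸ (i + j)                        ≡⟨ cong (λ x → (x + L j + 1) ∸ (i + j)) Li ⟩
    (a + i + L j + 1) ∸ (i + j)                      ≡⟨ cong (λ x → (x + i + L j + 1) ∸ (i + j)) (m+[n∸m]≡n c≤a) ⟨
    (c + (a ∸ c) + i + L j + 1) ∸ (i + j)            ≡⟨ cong (_∸ (i + j)) (solve 4 (λ c e i l → c :+ e :+ i :+ l :+ con 1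
                                                                          := e :+ (i :+ (con 1 :+ (l :+ c)))) refl c (a ∸ c) i (L j)) ⟩
    ((a ∸ c) + (i + suc (L j + c))) ∸ (i + j)        ≡⟨ cong (λ x → ((a ∸ c) + (i + x)) ∸ (i + j)) Lj ⟩
    ((a ∸ c) + (i + j)) ∸ (i + j)                    ≡⟨ m+n∸n≡m (a ∸ c) (i + j) ⟩
    a ∸ c                                            ∎
    where open ≡-Reasoning

  frob-diagonal : ∀ {i a} → L i ≡ a + i → i ≤ L i
  frob-diagonal {i} {a} Li = subst (i ≤_) (sym Li) (m≤n+m i a)

  frob-of-diagonal : ∀ {i} → 1 ≤ i → i ≤ L i → Frob (L i ∸ i)
  frob-of-diagonal {i} 1≤i i≤Li = i , 1≤i , sym (m∸n+n≡m i≤Li)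

  cofrob-of-offDiagonal : ∀ {j} → 1 ≤ j → L j < j → CoFrob (j ∸ suc (L j))
  cofrob-of-offDiagonal {j} 1≤j Lj<j = j , 1≤j , m+[n∸m]≡n Lj<j

  diagonal-box : ∀ {i j} → 1 ≤ i → i ≤ L i → j ≤ L j → j ≤ L i
  diagonal-box {i} {j} 1≤i i≤Li j≤Lj with ≤-total i j
  ... | inj₁ i≤j = transpose 1≤i (≤-trans i≤j j≤Lj)
  ... | inj₂ j≤i = ≤-trans j≤i i≤Li

  frob-cofrob-box : ∀ {i j a c} → 1 ≤ i → c ≤ a → L i ≡ a + i → suc (L j + c) ≡ j → j ≤ L i
  frob-cofrob-box {i} {j} {a} {c} 1≤i c≤a Li Lj with i ≤? L j
  ... | yes i≤Lj = transpose 1≤i i≤Lj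
  ... | no i≰Lj = subst₂ _≤_ Lj (trans (+-comm i a) (sym Li)) (+-mono-≤ (≰⇒> i≰Lj) c≤a)

  frob-cofrob-disjoint : ∀ {c} → Frob c → ¬ CoFrob c
  frob-cofrob-disjoint {c} (i , 1≤i , Li) (j , 1≤j , Lj) = <-irrefl refl (begin-strict
    L i          ≡⟨ Li ⟩
    c + i        ≤⟨ +-monoʳ-≤ c (transpose 1≤j j≤Li) ⟩
    c + L j      <⟨ ≤-reflexive (cong suc (+-comm c (L j))) ⟩
    suc (L j + c) ≡⟨ Lj ⟩
    j            ≤⟨ j≤Li ⟩
    L i          ∎)
    where
    open ≤-Reasoning
    j≤Li = frob-cofrob-box 1≤i ≤-refl Li Lj

  -- Walk down the diagonal j = i + c until the boundary of the diagram is crossed;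
  -- n bounds the number of remaining steps, since a box (i, 1) forces i ≤ L 1.
  frob⊎cofrob : ∀ c → Frob c ⊎ CoFrob c
  frob⊎cofrob c = walk (L 1) 0 (≤-reflexive (sym (+-identityʳ (L 1)))) z≤n
    where
    walk : ∀ n m → L 1 ≤ n + m → m ≤ L (c + suc m) → Frob c ⊎ CoFrob c
    walk n m bound m≤Lj with <-cmp (L (suc m)) (c + suc m)
    ... | tri≈ _ Lsm≡ _ = inj₁ (suc m , s≤s z≤n , Lsm≡)
    ... | tri< Lsm< _ _ = inj₂ (j , ≤-trans (s≤s z≤n) (m≤n+m (suc m) c) , Lj≡)
      where
      j = c + suc m
      Lj≤m : L j ≤ m
      Lj≤m = ≮⇒≥ (λ m<Lj → <⇒≱ Lsm< (transpose (s≤s z≤n) m<Lj))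
      Lj≡ : suc (L j + c) ≡ j
      Lj≡ rewrite ≤-antisym Lj≤m m≤Lj = trans (cong suc (+-comm m c)) (sym (+-suc c m))
    ... | tri> _ _ Lsm> = continue n bound
      where
      sm≤L1 : suc m ≤ L 1
      sm≤L1 = transpose (s≤s z≤n) (≤-trans (s≤s z≤n) Lsm>)
      continue : ∀ n → L 1 ≤ n + m → Frob c ⊎ CoFrob c
      continue zero bound = contradiction (≤-trans sm≤L1 bound) (n≮n m)
      continue (suc n) bound =
        walk n (suc m) (≤-trans bound (≤-reflexive (sym (+-suc n m))))
             (transpose (≤-trans (s≤s z≤n) (m≤n+m _ c)) (≤-trans (≤-reflexive (+-suc c (suc m))) Lsm>))

  hookFree⇒noPairSum : ∀ {t} → HookFree t → NoPairSum Frob t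
  hookFree⇒noPairSum {t} hookFree (i , 1≤i , Li) (j , 1≤j , Lj) pairSum≡t =
    hookFree 1≤i 1≤j (diagonal-box 1≤i (frob-diagonal Li) (frob-diagonal Lj))
      (subst (t ∣_) (sym (trans (Hook-frob-frob Li Lj) pairSum≡t)) ∣-refl)

  hookFree⇒downClosed : ∀ {t} → HookFree t → DownClosed Frob t
  hookFree⇒downClosed {t} hookFree x (i , 1≤i , Li) with frob⊎cofrob x
  ... | inj₁ frob = frob
  ... | inj₂ (j , 1≤j , Lj) =
    contradiction (subst (t ∣_) (sym Hook≡t) ∣-refl) (hookFree 1≤i 1≤j (frob-cofrob-box 1≤i (m≤m+n x t) Li Lj))
    where
    Hook≡t : Hook i j ≡ t
    Hook≡t = trans (Hook-frob-cofrob (m≤m+n x t) Li Lj) (m+n∸m≡n x t)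

  downClosed⇒offDiagonal-hookFree : ∀ {t} → DownClosed Frob t →
                                    ∀ {i j} → 1 ≤ i → 1 ≤ j → i ≤ L i → L j < j → j ≤ L i → ¬ t ∣ Hook i j
  downClosed⇒offDiagonal-hookFree {t} downClosed {i} {j} 1≤i 1≤j i≤Li Lj<j j≤Li t∣ =
    downClosed⇒∤difference downClosed (frob-of-diagonal 1≤i i≤Li) (λ Dc → frob-cofrob-disjoint Dc cofrob) c<a
      (subst (t ∣_) (Hook-frob-cofrob (<⇒≤ c<a) (sym (m∸n+n≡m i≤Li)) (proj₂ (proj₂ cofrob))) t∣)
    where
    a = L i ∸ i
    c = j ∸ suc (L j)
    cofrob : CoFrob c
    cofrob = cofrob-of-offDiagonal 1≤j Lj<j
    c<a : c < a
    c<a = +-cancelʳ-≤ (L j) (suc c) a (begin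
      suc (c + L j)   ≡⟨ cong suc (+-comm c (L j)) ⟩
      suc (L j + c)   ≡⟨ proj₂ (proj₂ cofrob) ⟩
      j               ≤⟨ j≤Li ⟩
      L i             ≡⟨ m∸n+n≡m i≤Li ⟨
      a + i           ≤⟨ +-monoʳ-≤ a (transpose 1≤j j≤Li) ⟩
      a + L j         ∎)
      where open ≤-Reasoning

  downClosed∧noPairSum⇒hookFree : ∀ {t} .{{_ : NonZero t}} → DownClosed Frob t → NoPairSum Frob t → HookFree t
  downClosed∧noPairSum⇒hookFree {t} downClosed noPairSum {i} {j} 1≤i 1≤j j≤Li t∣ with i ≤? L i | j ≤? L j
  ... | yes i≤Li | yes j≤Lj =
    downClosed⇒∤pairSum downClosed noPairSum (frob-of-diagonal 1≤i i≤Li) (frob-of-diagonal 1≤j j≤Lj)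
      (subst (t ∣_) (Hook-frob-frob (sym (m∸n+n≡m i≤Li)) (sym (m∸n+n≡m j≤Lj))) t∣)
  ... | yes i≤Li | no j≰Lj = downClosed⇒offDiagonal-hookFree downClosed 1≤i 1≤j i≤Li (≰⇒> j≰Lj) j≤Li t∣
  ... | no i≰Li | yes j≤Lj = downClosed⇒offDiagonal-hookFree downClosed 1≤j 1≤i j≤Lj (≰⇒> i≰Li) (transpose 1≤j j≤Li) (subst (t ∣_) (Hook-comm i j) t∣)
  ... | no i≰Li | no j≰Lj =
    contradiction (≤-trans j≤Li (<⇒≤ (≰⇒> i≰Li))) (<⇒≱ (≤-<-trans (transpose 1≤j j≤Li) (≰⇒> j≰Lj)))
  hookFree⇔ : ∀ {t} .{{_ : NonZero t}} → HookFree t ⇔ (DownClosed Frob t × NoPairSum Frob t)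
  hookFree⇔ {t} = mk⇔
    (λ (hookFree : HookFree t) → hookFree⇒downClosed hookFree , λ {_} {_} → hookFree⇒noPairSum hookFree)
    (uncurry downClosed∧noPairSum⇒hookFree)

data Generator (s : ℕ) : ℕ → Set where
  gen₀ : Generator s s
  gen₁ : Generator s (suc s)
  gen₂ : Generator s (suc (suc s))

generator-nonZero : ∀ {s t} → 1 ≤ s → Generator s t → NonZero t
generator-nonZero 1≤s gen₀ = >-nonZero 1≤s
generator-nonZero _ gen₁ = _
generator-nonZero _ gen₂ = _

data Generated (s : ℕ) : ℕ → Set where
  ε   : Generated s 0
  _∙_ : ∀ {t n} → Generator s t → Generated s n → Generated s (t + n)

data CombGenerator (s : ℕ) : ℕ → Set where
  double   : ∀ {t} → Generator s t → CombGenerator s (t + t)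
  adjacent : ∀ {t} → Generator s t → Generator s (suc t) → CombGenerator s (t + suc t)

combGenerator : ∀ {s k} → k ≤ 4 → CombGenerator s (2 * s + k)
combGenerator {s} {0} _ = subst (CombGenerator s) (solve 1 (λ s → s :+ s := con 2 :* s :+ con 0) refl s) (double gen₀)
combGenerator {s} {1} _ =
  subst (CombGenerator s) (solve 1 (λ s → s :+ (con 1 :+ s) := con 2 :* s :+ con 1) refl s) (adjacent gen₀ gen₁)
combGenerator {s} {2} _ =
  subst (CombGenerator s) (solve 1 (λ s → (con 1 :+ s) :+ (con 1 :+ s) := con 2 :* s :+ con 2) refl s) (double gen₁)
combGenerator {s} {3} _ =
  subst (CombGenerator s) (solve 1 (λ s → (con 1 :+ s) :+ (con 2 :+ s) := con 2 :* s :+ con 3) refl s) (adjacent gen₁ gen₂)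
combGenerator {s} {4} _ =
  subst (CombGenerator s) (solve 1 (λ s → (con 2 :+ s) :+ (con 2 :+ s) := con 2 :* s :+ con 4) refl s) (double gen₂)
combGenerator {k = suc (suc (suc (suc (suc _))))} (s≤s (s≤s (s≤s (s≤s ()))))

comb⇒generated : ∀ {s c} → Comb s c → Generated s c
comb⇒generated comb-zero = ε
comb⇒generated (comb-add k≤4 c) = prepend (combGenerator k≤4) (comb⇒generated c)
  where
  prepend : ∀ {s m n} → CombGenerator s m → Generated s n → Generated s (m + n)
  prepend {n = n} (double {t} g) gn = subst (Generated _) (sym (+-assoc t t n)) (g ∙ (g ∙ gn))
  prepend {n = n} (adjacent {t} g g′) gn = subst (Generated _) (sym (+-assoc t (suc t) n)) (g ∙ (g′ ∙ gn))

-- An odd element keeps a spare generator t, to be paired with the next odd step.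
HalfGenerated : ℕ → ℕ → Set
HalfGenerated s c = (∃[ d ] (Generated s d × c ≡ 2 * d))
                  ⊎ (∃₂ λ d t → Generated s d × Generator s t × c ≡ suc (2 * (d + t)))

comb⇒halfGenerated : ∀ {s c} → Comb s c → HalfGenerated s c
comb⇒halfGenerated comb-zero = inj₁ (0 , ε , refl)
comb⇒halfGenerated (comb-add k≤4 c) = prepend (combGenerator k≤4) (comb⇒halfGenerated c)
  where
  prepend : ∀ {s m n} → CombGenerator s m → HalfGenerated s n → HalfGenerated s (m + n)
  prepend (double {t} g) (inj₁ (d , gd , refl)) =
    inj₁ (t + d , g ∙ gd , solve 2 (λ t d → t :+ t :+ con 2 :* d := con 2 :* (t :+ d)) refl t d)
  prepend (double {t} g) (inj₂ (d , u , gd , gu , refl)) =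
    inj₂ (t + d , u , g ∙ gd , gu ,
          solve 3 (λ t d u → t :+ t :+ (con 1 :+ con 2 :* (d :+ u)) := con 1 :+ con 2 :* (t :+ d :+ u)) refl t d u)
  prepend (adjacent {t} g _) (inj₁ (d , gd , refl)) =
    inj₂ (d , t , gd , g , solve 2 (λ t d → t :+ (con 1 :+ t) :+ con 2 :* d := con 1 :+ con 2 :* (d :+ t)) refl t d)
  prepend (adjacent {t} _ g′) (inj₂ (d , u , gd , gu , refl)) =
    inj₁ (u + (suc t + d) , gu ∙ (g′ ∙ gd) ,
          solve 3 (λ t d u → t :+ (con 1 :+ t) :+ (con 1 :+ con 2 :* (d :+ u)) := con 2 :* (u :+ (con 1 :+ t :+ d)))
                refl t d u)

comb-+ : ∀ {s m n} → Comb s m → Comb s n → Comb s (m + n)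
comb-+ comb-zero cn = cn
comb-+ {s} {n = n} (comb-add {k} {m} k≤4 cm) cn =
  subst (Comb s) (sym (+-assoc (2 * s + k) m n)) (comb-add k≤4 (comb-+ cm cn))

comb-double : ∀ {s t} → Generator s t → Comb s (2 * t)
comb-double {s} gen₀ = subst (Comb s) (solve 1 (λ s → con 2 :* s :+ con 0 :+ con 0 := con 2 :* s) refl s)
                             (comb-add {k = 0} z≤n comb-zero)
comb-double {s} gen₁ = subst (Comb s) (solve 1 (λ s → con 2 :* s :+ con 2 :+ con 0 := con 2 :* (con 1 :+ s)) refl s)
                             (comb-add {k = 2} (s≤s (s≤s z≤n)) comb-zero)
comb-double {s} gen₂ = subst (Comb s) (solve 1 (λ s → con 2 :* s :+ con 4 :+ con 0 := con 2 :* (con 2 :+ s)) refl s)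
                             (comb-add {k = 4} (s≤s (s≤s (s≤s (s≤s z≤n)))) comb-zero)

LeP-trans : ∀ {s a b c} → LeP s a b → LeP s b c → LeP s a c
LeP-trans {a = a} (Pa , _ , d , Cd , b≡a+d) (_ , Pc , e , Ce , c≡b+e) =
  Pa , Pc , d + e , comb-+ Cd Ce , trans c≡b+e (trans (cong (_+ e) b≡a+d) (+-assoc a d e))

InPtilde-lower : ∀ {s a b} → InPtilde s b → Odd a → LeP s a b → InPtilde s a
InPtilde-lower {s} {a} {b} (_ , _ , s≰b , s+1≰b , s+2≰b) odd a≤b@(Pa , _) =
  Pa , odd , s≰b ∘ ≤a⇒≤b , s+1≰b ∘ ≤a⇒≤b , s+2≰b ∘ ≤a⇒≤b
  where
  ≤a⇒≤b : ∀ {r} → LeP s r a → LeP s r b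
  ≤a⇒≤b r≤a = LeP-trans r≤a a≤b

BadSum : ℕ → ℕ → Set
BadSum s m = m ≡ 2 * s ⊎ m ≡ 2 * s + 2 ⊎ m ≡ 2 * s + 4

2*[1+s]≡2*s+2 : ∀ s → 2 * suc s ≡ 2 * s + 2
2*[1+s]≡2*s+2 s = solve 1 (λ s → con 2 :* (con 1 :+ s) := con 2 :* s :+ con 2) refl s

2*[2+s]≡2*s+4 : ∀ s → 2 * suc (suc s) ≡ 2 * s + 4
2*[2+s]≡2*s+4 s = solve 1 (λ s → con 2 :* (con 2 :+ s) := con 2 :* s :+ con 4) refl s

generator⇒badSum : ∀ {s n} → Generator s n → BadSum s (2 * n)
generator⇒badSum gen₀ = inj₁ refl
generator⇒badSum {s} gen₁ = inj₂ (inj₁ (2*[1+s]≡2*s+2 s))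
generator⇒badSum {s} gen₂ = inj₂ (inj₂ (2*[2+s]≡2*s+4 s))

badSum⇒generator : ∀ {s n} → BadSum s (2 * n) → Generator s n
badSum⇒generator {s} {n} (inj₁ 2n≡) = subst (Generator s) (sym (*-cancelˡ-≡ n s 2 2n≡)) gen₀
badSum⇒generator {s} {n} (inj₂ (inj₁ 2n≡)) =
  subst (Generator s) (sym (*-cancelˡ-≡ n (suc s) 2 (trans 2n≡ (sym (2*[1+s]≡2*s+2 s))))) gen₁
badSum⇒generator {s} {n} (inj₂ (inj₂ 2n≡)) =
  subst (Generator s) (sym (*-cancelˡ-≡ n (suc (suc s)) 2 (trans 2n≡ (sym (2*[2+s]≡2*s+4 s))))) gen₂

oddSum : ∀ a b → suc (2 * a) + suc (2 * b) ≡ 2 * suc (a + b)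
oddSum = solve 2 (λ a b → con 1 :+ con 2 :* a :+ (con 1 :+ con 2 :* b) := con 2 :* (con 1 :+ (a :+ b))) refl

Admissible : ℕ → (ℕ → Set) → Set
Admissible s D = ∀ {t} → Generator s t → DownClosed D t × NoPairSum D t

module _ {s : ℕ} {D : ℕ → Set} (admissible : Admissible s D) where

  downClosed-generated : ∀ {d} → Generated s d → DownClosed D d
  downClosed-generated ε x = subst D (+-identityʳ x)
  downClosed-generated (_∙_ {t} {n} g gn) x Dx+t+n =
    downClosed-generated gn x (proj₁ (admissible g) (x + n) (subst D (x+[t+n]≡x+n+t) Dx+t+n))
    where
    x+[t+n]≡x+n+t : x + (t + n) ≡ x + n + t
    x+[t+n]≡x+n+t = solve 3 (λ x t n → x :+ (t :+ n) := x :+ n :+ t) refl x t n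

  pairSum∉generated : ∀ {d} → Generated s d → ∀ {a b} → D a → D b → suc (a + b) ≢ d
  pairSum∉generated ε _ _ ()
  pairSum∉generated (_∙_ {t} {n} g gn) {a} {b} Da Db a+b+1≡t+n with t ≤? a
  ... | yes t≤a = pairSum∉generated gn (proj₁ (admissible g) (a ∸ t) (subst D (sym (m∸n+n≡m t≤a)) Da)) Db
                    (+-cancelˡ-≡ t _ _ (trans shift a+b+1≡t+n))
    where
    shift : t + suc (a ∸ t + b) ≡ suc (a + b)
    shift = begin
      t + suc (a ∸ t + b)   ≡⟨ solve 3 (λ t x b → t :+ (con 1 :+ (x :+ b)) := con 1 :+ (x :+ t :+ b)) refl t (a ∸ t) b ⟩
      suc (a ∸ t + t + b)   ≡⟨ cong (λ x → suc (x + b)) (m∸n+n≡m t≤a) ⟩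
      suc (a + b)           ∎
      where open ≡-Reasoning
  ... | no t≰a = proj₂ (admissible g) Da (downClosed-generated gn c (subst D b≡c+n Db)) a+c+1≡t
    where
    c = t ∸ suc a
    a+c+1≡t : suc (a + c) ≡ t
    a+c+1≡t = m+[n∸m]≡n (≰⇒> t≰a)
    b≡c+n : b ≡ c + n
    b≡c+n = +-cancelˡ-≡ (suc a) _ _ (trans a+b+1≡t+n (trans (cong (_+ n) (sym a+c+1≡t)) (+-assoc (suc a) c n)))

  odd∉generated : ∀ {a} → D a → ¬ Generated s (suc (2 * a))
  odd∉generated {a} Da ga = pairSum∉generated ga Da Da (cong (λ x → suc (a + x)) (sym (+-identityʳ a)))

module OddImage {s : ℕ} {D I : ℕ → Set}
  (I⇒D : ∀ {h} → I h → ∃[ a ] (D a × h ≡ suc (2 * a)))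
  (D⇒I : ∀ {a} → D a → I (suc (2 * a))) where

  module _ (admissible : Admissible s D) where

    I⊆P̃ : ∀ h → I h → InPtilde s h
    I⊆P̃ h Ih with I⇒D Ih
    ... | a , Da , refl = (s≤s z≤n , odd∉generated admissible Da ∘ comb⇒generated) , (a , refl) , ≰ gen₀ , ≰ gen₁ , ≰ gen₂
      where
      ≰ : ∀ {r} → Generator s r → ¬ LeP s r (suc (2 * a))
      ≰ g (_ , _ , c , Cc , h≡r+c) = odd∉generated admissible Da (subst (Generated s) (sym h≡r+c) (g ∙ comb⇒generated Cc))

    I-lower : ∀ a b → InPtilde s a → InPtilde s b → LeP s a b → I b → I a
    I-lower _ b (_ , (α , refl) , _) _ (_ , _ , c , Cc , b≡a+c) Ib with I⇒D Ib | comb⇒halfGenerated Cc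
    ... | β , Dβ , refl | inj₁ (d , gd , refl) =
      D⇒I (downClosed-generated admissible gd α (subst D (*-cancelˡ-≡ β (α + d) 2 2β≡) Dβ))
      where
      2β≡ : 2 * β ≡ 2 * (α + d)
      2β≡ = trans (suc-injective b≡a+c) (sym (*-distribˡ-+ 2 α d))
    ... | β , Dβ , refl | inj₂ (d , t , _ , _ , refl) = ⊥-elim (even≢odd β (α + (d + t)) 2β≡)
      where
      2β≡ : 2 * β ≡ suc (2 * (α + (d + t)))
      2β≡ = trans (suc-injective b≡a+c)
                  (solve 3 (λ α d t → con 2 :* α :+ (con 1 :+ con 2 :* (d :+ t)) := con 1 :+ con 2 :* (α :+ (d :+ t)))
                         refl α d t)

    noBadSum : NoBadSum s I
    noBadSum _ _ I₁ I₂ bad with I⇒D I₁ | I⇒D I₂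
    ... | a , Da , refl | b , Db , refl =
      proj₂ (admissible (badSum⇒generator (subst (BadSum s) (oddSum a b) bad))) Da Db refl

  admissible⇒ideal : Admissible s D → LowerIdealPtilde s I × NoBadSum s I
  admissible⇒ideal admissible = (I⊆P̃ admissible , I-lower admissible) , noBadSum admissible

  module _ (ideal : LowerIdealPtilde s I) where

    -- 2x+1 lies 2t below 2(x+t)+1 in P, and 2t ∈ S for every generator t.
    lowerIdeal⇒downClosed : ∀ {t} → Generator s t → DownClosed D t
    lowerIdeal⇒downClosed {t} g x Dx+t with I⇒D (proj₂ ideal h′ h P̃h′ P̃h h′≤h Ih)
      where
      h = suc (2 * (x + t))
      h′ = suc (2 * x)
      Ih : I h
      Ih = D⇒I Dx+t
      P̃h : InPtilde s h
      P̃h = proj₁ ideal h Ih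
      h≡h′+2t : h ≡ h′ + 2 * t
      h≡h′+2t = cong suc (*-distribˡ-+ 2 x t)
      h′≤h : LeP s h′ h
      h′≤h = (s≤s z≤n , λ Ch′ → proj₂ (proj₁ P̃h) (subst (Comb s) (sym h≡h′+2t) (comb-+ Ch′ (comb-double g))))
           , proj₁ P̃h , 2 * t , comb-double g , h≡h′+2t
      P̃h′ : InPtilde s h′
      P̃h′ = InPtilde-lower P̃h (x , refl) h′≤h
    ... | α , Dα , h′≡ = subst D (sym (*-cancelˡ-≡ x α 2 (suc-injective h′≡))) Dα

  noBadSum⇒noPairSum : NoBadSum s I → ∀ {t} → Generator s t → NoPairSum D t
  noBadSum⇒noPairSum noBad g {a} {b} Da Db a+b+1≡t =
    noBad _ _ (D⇒I Da) (D⇒I Db) (subst (BadSum s) (sym (oddSum a b)) (generator⇒badSum (subst (Generator s) (sym a+b+1≡t) g)))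

  ideal⇒admissible : LowerIdealPtilde s I × NoBadSum s I → Admissible s D
  ideal⇒admissible (ideal , noBad) g = lowerIdeal⇒downClosed ideal g , noBadSum⇒noPairSum noBad g

module SelfConjugatePartition {la : List ℕ} (decreasing : Decreasing la) (selfConj : SelfConjugate la) where

  part≡conjPart : ∀ {j} → 1 ≤ j → part la j ≡ conjPart la j
  part≡conjPart {suc k} _ = trans (cong (λ μ → part μ (suc k)) selfConj) (part-conj decreasing k)

  transpose : ∀ {i j} → 1 ≤ j → j ≤ part la i → i ≤ part la j
  transpose {i} 1≤j j≤part =
    subst (i ≤_) (sym (part≡conjPart 1≤j)) (≤-part⇒≤-conjPart decreasing i 1≤j j≤part)

  hook≡ : ∀ i {j} → 1 ≤ j → hook la i j ≡ (part la i + part la j + 1) ∸ (i + j)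
  hook≡ i {j} 1≤j = cong (λ μ → (part la i + μ + 1) ∸ (i + j)) (sym (part≡conjPart 1≤j))

  open Frobenius (part la) transpose public

  isCore⇔hookFree : ∀ t → IsCore t la ⇔ HookFree t
  isCore⇔hookFree t = mk⇔
    (λ core {i} {j} 1≤i 1≤j j≤Li t∣ → core i j (1≤i , 1≤j , j≤Li) (subst (t ∣_) (sym (hook≡ i 1≤j)) t∣))
    (λ hookFree i _ (1≤i , 1≤j , j≤Li) t∣ → hookFree 1≤i 1≤j j≤Li (subst (t ∣_) (hook≡ i 1≤j) t∣))

  isCore⇔downClosed×noPairSum : ∀ t .{{_ : NonZero t}} → IsCore t la ⇔ (DownClosed Frob t × NoPairSum Frob t)
  isCore⇔downClosed×noPairSum t = ⇔-trans (isCore⇔hookFree t) hookFree⇔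

  diagonalHook : ∀ {i a} → 1 ≤ i → part la i ≡ a + i → hook la i i ≡ suc (2 * a)
  diagonalHook {i} {a} 1≤i Li =
    trans (hook≡ i 1≤i) (trans (Hook-frob-frob Li Li) (cong (λ x → suc (a + x)) (sym (+-identityʳ a))))

  MD⇒frob : ∀ {h} → MD la h → ∃[ a ] (Frob a × h ≡ suc (2 * a))
  MD⇒frob (i , (1≤i , _ , i≤Li) , refl) =
    part la i ∸ i , frob-of-diagonal 1≤i i≤Li , diagonalHook 1≤i (sym (m∸n+n≡m i≤Li))

  frob⇒MD : ∀ {a} → Frob a → MD la (suc (2 * a))
  frob⇒MD (i , 1≤i , Li) = i , (1≤i , 1≤i , frob-diagonal Li) , diagonalHook 1≤i Li

proposition2p2 : (s : ℕ) → 1 ≤ s → (la : List ℕ) → IsPartition la → SelfConjugate la →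
    ((IsCore s la × IsCore (suc s) la × IsCore (suc (suc s)) la) ⇔
     (LowerIdealPtilde s (MD la) × NoBadSum s (MD la)))
proposition2p2 s 1≤s la (decreasing , _) selfConj = mk⇔
  (λ (core₀ , core₁ , core₂) → admissible⇒ideal λ { gen₀ → to gen₀ core₀ ; gen₁ → to gen₁ core₁ ; gen₂ → to gen₂ core₂ })
  (λ ideal → let admissible = ideal⇒admissible ideal
             in from gen₀ (admissible gen₀) , from gen₁ (admissible gen₁) , from gen₂ (admissible gen₂))
  where
  open SelfConjugatePartition decreasing selfConj
  open OddImage {s} MD⇒frob frob⇒MD

  core⇔admissible : ∀ {t} → Generator s t → IsCore t la ⇔ (DownClosed Frob t × NoPairSum Frob t)
  core⇔admissible g = isCore⇔downClosed×noPairSum _ {{generator-nonZero 1≤s g}}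

  to : ∀ {t} → Generator s t → IsCore t la → DownClosed Frob t × NoPairSum Frob t
  to g = Equivalence.to (core⇔admissible g)

  from : ∀ {t} → Generator s t → DownClosed Frob t × NoPairSum Frob t → IsCore t la
  from g = Equivalence.from (core⇔admissible g)
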